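{- There exists a finite subgraph with unfinished edges, in which every vertex $v$ satisfies $\rho(v)\le 1$ and $\delta(v)\le 1$, and which has three distinguished unfinished edges $e_1,e_2,e_3$, such that: (i) every assignment in which each of $e_1,e_2,e_3$ is directed either toward or away from the subgraph, with at least one of them directed toward the subgraph, can be extended to an orientation of the whole subgraph; and (ii) the assignment in which all three of $e_1,e_2,e_3$ are directed away from the subgraph cannot be extended to an orientation of the subgraph.
   Context: A "subgraph with unfinished edges" consists of a finite set of vertices, a set of edges each of which either joins two of these vertices or is an "unfinished edge" having exactly one endpoint in the vertex set (its other end unspecified), and for each vertex $v$ prescribed nonnegative integers $\rho(v)$ (in-degree), $\delta(v)$ (out-degree), $\theta(v)$ (undirected-degree). An "orientation" of such a subgraph assigns to each edge (including each unfinished edge) either one of its two directions or the status "undirected" (for an unfinished edge, the two directions are "toward the subgraph", i.e.\ into its endpoint, and "away from the subgraph"), such that every vertex $v$ has exactly $\rho(v)$ incoming directed edges, $\delta(v)$ outgoing directed edges, and $\theta(v)$ incident undirected edges. An assignment of directions to some edges "extends to an orientation" if there is an orientation agreeing with it on those edges (other unfinished edges may be treated arbitrarily). -}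

module Defs where

open import Data.Nat using (ℕ; _+_; _≤_)
open import Data.Fin using (Fin; _≟_)
open import Data.List using (List; map; allFin)
open import Data.Nat.ListAction using (sum)
open import Data.Bool using (if_then_else_)
open import Data.Product using (Σ; _×_; ∃)
open import Relation.Nullary using (¬_)
open import Relation.Nullary.Decidable using (⌊_⌋)
open import Relation.Binary.PropositionalEquality using (_≡_; _≢_)

data Edge (n : ℕ) : Set where
  inner      : (u v : Fin n) → u ≢ v → Edge n
  unfinished : (w : Fin n) → Edge n

-- For  inner u v _ :  fwd = directed u → v,  bwd = directed v → u.
-- For  unfinished w :  fwd = directed toward the subgraph (into w),
--                      bwd = directed away from the subgraph (out of w).
-- und = undirected.
data Status : Set where
  fwd bwd und : Status

record SubgraphUE : Set where
  field
    n : ℕ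
    m : ℕ
    edge : Fin m → Edge n
    ρ δ θ : Fin n → ℕ     -- prescribed in-, out-, undirected degree

[_≟'_] : {n : ℕ} → Fin n → Fin n → ℕ
[ x ≟' y ] = if ⌊ x ≟ y ⌋ then 1 else 0

inC outC undC : {n : ℕ} → Edge n → Status → Fin n → ℕ
inC (inner u v _) fwd w = [ v ≟' w ]
inC (inner u v _) bwd w = [ u ≟' w ]
inC (inner u v _) und w = 0
inC (unfinished x) fwd w = [ x ≟' w ]
inC (unfinished x) bwd w = 0
inC (unfinished x) und w = 0
outC (inner u v _) fwd w = [ u ≟' w ]
outC (inner u v _) bwd w = [ v ≟' w ]
outC (inner u v _) und w = 0
outC (unfinished x) fwd w = 0
outC (unfinished x) bwd w = [ x ≟' w ]
outC (unfinished x) und w = 0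
undC (inner u v _) fwd w = 0
undC (inner u v _) bwd w = 0
undC (inner u v _) und w = [ u ≟' w ] + [ v ≟' w ]
undC (unfinished x) fwd w = 0
undC (unfinished x) bwd w = 0
undC (unfinished x) und w = [ x ≟' w ]

module _ (G : SubgraphUE) where
  open SubgraphUE G

  inDeg outDeg undDeg : (Fin m → Status) → Fin n → ℕ
  inDeg  o w = sum (map (λ e → inC  (edge e) (o e) w) (allFin m))
  outDeg o w = sum (map (λ e → outC (edge e) (o e) w) (allFin m))
  undDeg o w = sum (map (λ e → undC (edge e) (o e) w) (allFin m))

  IsOrientation : (Fin m → Status) → Set
  IsOrientation o = ∀ w → inDeg o w ≡ ρ w × outDeg o w ≡ δ w × undDeg o w ≡ θ w

  IsUnfinished : Fin m → Set
  IsUnfinished e = Σ (Fin n) λ w → edge e ≡ unfinished w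

  Extends3 : Fin m → Status → Fin m → Status → Fin m → Status → Set
  Extends3 e₁ s₁ e₂ s₂ e₃ s₃ =
    Σ (Fin m → Status) λ o → IsOrientation o × o e₁ ≡ s₁ × o e₂ ≡ s₂ × o e₃ ≡ s₃

data Dir : Set where
  toward away : Dir

dirStatus : Dir → Status
dirStatus toward = fwd
dirStatus away   = bwd

-- The gadget is a star: a hub with ρ = 1, δ = 0, θ = 2 joined to three spokes with
-- ρ = δ = θ = 1, each spoke carrying two unfinished edges eᵢ and fᵢ.  Counting every
-- directed edge once at its head and once at its tail shows that in any orientation
-- Σρ − Σδ equals the number of unfinished edges pointing toward the subgraph minus the
-- number pointing away.  Here Σρ − Σδ = 4 − 3 = 1, so if e₁, e₂, e₃ all point away,
-- f₁, f₂, f₃ would have to supply a surplus of 4 incoming edges, which three edges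
-- cannot do.  In every other case an explicit orientation exists.
module Submission where

open import Defs
open import Data.Nat using (ℕ; zero; suc; _+_; _≤_; z≤n; s≤s)
open import Data.Nat.Properties
  using (_≟_; +-0-commutativeMonoid; +-mono-≤; +-monoʳ-≤; n≮n; module ≤-Reasoning)
open import Data.Nat.ListAction using (sum)
open import Data.Fin using (Fin; zero; suc; #_; punchIn)
open import Data.Fin.Properties using (all?; punchInᵢ≢i) renaming (_≟_ to _≟ᶠ_)
open import Data.List using (map; tabulate; allFin)
open import Data.Vec using (_∷_; []; lookup)
open import Data.Product using (Σ; _×_; _,_; proj₁; proj₂)
open import Data.Sum using (_⊎_; inj₁; inj₂)
open import Function using (_∘_; id)
open import Relation.Nullary using (¬_; Dec; yes; no; contradiction)
open import Relation.Nullary.Decidable using (_×-dec_; True; toWitness)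
open import Relation.Binary.PropositionalEquality
  using (_≡_; _≢_; refl; sym; trans; cong; cong₂; module ≡-Reasoning)
open import Algebra.Properties.CommutativeMonoid.Sum +-0-commutativeMonoid
  using (∑-comm; ∑-distrib-+; sum-cong-≗; sum-remove; sum-replicate-zero)
  renaming (sum to ∑)

indicator-refl : ∀ {n} (x : Fin n) → [ x ≟' x ] ≡ 1
indicator-refl x with x ≟ᶠ x
... | yes _   = refl
... | no x≢x = contradiction refl x≢x

indicator-≢ : ∀ {n} {x y : Fin n} → x ≢ y → [ x ≟' y ] ≡ 0
indicator-≢ {x = x} {y} x≢y with x ≟ᶠ y
... | yes x≡y = contradiction x≡y x≢y
... | no _    = refl

∑-indicator : ∀ {n} (x : Fin n) → ∑ (λ w → [ x ≟' w ]) ≡ 1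
∑-indicator {suc n} x = begin
  ∑ (λ w → [ x ≟' w ])                          ≡⟨ sum-remove {i = x} (λ w → [ x ≟' w ]) ⟩
  [ x ≟' x ] + ∑ (λ j → [ x ≟' punchIn x j ])   ≡⟨ cong₂ _+_ (indicator-refl x)
                                                           (sum-cong-≗ (λ j → indicator-≢ (punchInᵢ≢i x j ∘ sym))) ⟩
  1 + ∑ {n} (λ _ → 0)                           ≡⟨ cong (1 +_) (sum-replicate-zero n) ⟩
  1                                             ∎
  where open ≡-Reasoning

sum-map-tabulate : ∀ {a} {A : Set a} {n} (f : A → ℕ) (g : Fin n → A) →
                   sum (map f (tabulate g)) ≡ ∑ (f ∘ g)
sum-map-tabulate {n = zero}  f g = refl
sum-map-tabulate {n = suc n} f g = cong (f (g zero) +_) (sum-map-tabulate f (g ∘ suc))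

∑-mono-≤ : ∀ {n} {f g : Fin n → ℕ} → (∀ i → f i ≤ g i) → ∑ f ≤ ∑ g
∑-mono-≤ {zero}  _   = z≤n
∑-mono-≤ {suc n} f≤g = +-mono-≤ (f≤g zero) (∑-mono-≤ (f≤g ∘ suc))

entering leaving : ∀ {n} → Edge n → Status → ℕ
entering (unfinished _) fwd = 1
entering _              _   = 0
leaving  (unfinished _) bwd = 1
leaving  _              _   = 0

entering-≤1 : ∀ {n} (ed : Edge n) s → entering ed s ≤ 1
entering-≤1 (inner _ _ _)  _   = z≤n
entering-≤1 (unfinished _) fwd = s≤s z≤n
entering-≤1 (unfinished _) bwd = z≤n
entering-≤1 (unfinished _) und = z≤n

edge-balance : ∀ {n} (ed : Edge n) s → ∑ (inC ed s) + leaving ed s ≡ ∑ (outC ed s) + entering ed s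
edge-balance     (inner u v _)  fwd = cong (_+ 0) (trans (∑-indicator v) (sym (∑-indicator u)))
edge-balance     (inner u v _)  bwd = cong (_+ 0) (trans (∑-indicator u) (sym (∑-indicator v)))
edge-balance     (inner u v _)  und = refl
edge-balance {n} (unfinished x) fwd = trans (cong (_+ 0) (∑-indicator x)) (cong (_+ 1) (sym (sum-replicate-zero n)))
edge-balance {n} (unfinished x) bwd = trans (cong (_+ 1) (sum-replicate-zero n)) (cong (_+ 0) (sym (∑-indicator x)))
edge-balance     (unfinished x) und = refl

module _ (G : SubgraphUE) where
  open SubgraphUE G

  inflow outflow : (Fin m → Status) → ℕ
  inflow  o = ∑ (λ e → entering (edge e) (o e))
  outflow o = ∑ (λ e → leaving  (edge e) (o e))

  ∑-degree-swap : (c : Edge n → Status → Fin n → ℕ) (o : Fin m → Status) →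
                  ∑ (λ w → sum (map (λ e → c (edge e) (o e) w) (allFin m))) ≡ ∑ (λ e → ∑ (c (edge e) (o e)))
  ∑-degree-swap c o = trans (sum-cong-≗ (λ w → sum-map-tabulate (λ e → c (edge e) (o e) w) id))
                            (∑-comm (λ w e → c (edge e) (o e) w))

  flow-balance : ∀ o → ∑ (inDeg G o) + outflow o ≡ ∑ (outDeg G o) + inflow o
  flow-balance o = begin
    ∑ (inDeg G o) + outflow o                                    ≡⟨ cong (_+ outflow o) (∑-degree-swap inC o) ⟩
    ∑ (λ e → ∑ (inC (edge e) (o e))) + outflow o                 ≡⟨ ∑-distrib-+ (λ e → ∑ (inC (edge e) (o e))) (λ e → leaving (edge e) (o e)) ⟨
    ∑ (λ e → ∑ (inC (edge e) (o e)) + leaving (edge e) (o e))    ≡⟨ sum-cong-≗ (λ e → edge-balance (edge e) (o e)) ⟩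
    ∑ (λ e → ∑ (outC (edge e) (o e)) + entering (edge e) (o e))  ≡⟨ ∑-distrib-+ (λ e → ∑ (outC (edge e) (o e))) (λ e → entering (edge e) (o e)) ⟩
    ∑ (λ e → ∑ (outC (edge e) (o e))) + inflow o                 ≡⟨ cong (_+ inflow o) (∑-degree-swap outC o) ⟨
    ∑ (outDeg G o) + inflow o                                    ∎
    where open ≡-Reasoning

  orientation-balance : ∀ o → IsOrientation G o → ∑ ρ + outflow o ≡ ∑ δ + inflow o
  orientation-balance o is-o = begin
    ∑ ρ + outflow o            ≡⟨ cong (_+ outflow o) (sum-cong-≗ (proj₁ ∘ is-o)) ⟨
    ∑ (inDeg G o) + outflow o  ≡⟨ flow-balance o ⟩
    ∑ (outDeg G o) + inflow o  ≡⟨ cong (_+ inflow o) (sum-cong-≗ (proj₁ ∘ proj₂ ∘ is-o)) ⟩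
    ∑ δ + inflow o             ∎
    where open ≡-Reasoning

  isOrientation? : ∀ o → Dec (IsOrientation G o)
  isOrientation? o = all? λ w →
    (inDeg G o w ≟ ρ w) ×-dec (outDeg G o w ≟ δ w) ×-dec (undDeg G o w ≟ θ w)

  extends3-by : ∀ o {e₁ e₂ e₃} → True (isOrientation? o) → Extends3 G e₁ (o e₁) e₂ (o e₂) e₃ (o e₃)
  extends3-by o is-o = o , toWitness is-o , refl , refl , refl

-- Vertex 0 is the hub.  Edges 0–2 are e₁ e₂ e₃, edges 3–5 join the spokes to the hub,
-- edges 6–8 are f₁ f₂ f₃.
gadget : SubgraphUE
gadget = record
  { n    = 4
  ; m    = 9
  ; edge = lookup ( unfinished (# 1) ∷ unfinished (# 2) ∷ unfinished (# 3)
                  ∷ inner (# 1) (# 0) (λ ()) ∷ inner (# 2) (# 0) (λ ()) ∷ inner (# 3) (# 0) (λ ())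
                  ∷ unfinished (# 1) ∷ unfinished (# 2) ∷ unfinished (# 3) ∷ [])
  ; ρ    = λ _ → 1
  ; δ    = λ { zero → 0 ; (suc _) → 1 }
  ; θ    = λ { zero → 2 ; (suc _) → 1 }
  }

open SubgraphUE gadget using (edge; ρ; δ)

gadget-degrees : ∀ v → ρ v ≤ 1 × δ v ≤ 1
gadget-degrees zero    = s≤s z≤n , z≤n
gadget-degrees (suc _) = s≤s z≤n , s≤s z≤n

isSpare isDistinguished : Fin 9 → ℕ
isSpare (suc (suc (suc (suc (suc (suc _)))))) = 1
isSpare _                                     = 0
isDistinguished zero                = 1
isDistinguished (suc zero)          = 1
isDistinguished (suc (suc zero))    = 1
isDistinguished (suc (suc (suc _))) = 0

module _ (o : Fin 9 → Status) (o₁ : o (# 0) ≡ bwd) (o₂ : o (# 1) ≡ bwd) (o₃ : o (# 2) ≡ bwd) where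

  inflow≤3 : inflow gadget o ≤ 3
  inflow≤3 = ∑-mono-≤ {g = isSpare} entering≤isSpare
    where
    entering≤isSpare : ∀ e → entering (edge e) (o e) ≤ isSpare e
    entering≤isSpare zero                                    rewrite o₁ = z≤n
    entering≤isSpare (suc zero)                              rewrite o₂ = z≤n
    entering≤isSpare (suc (suc zero))                        rewrite o₃ = z≤n
    entering≤isSpare (suc (suc (suc zero)))                  = z≤n
    entering≤isSpare (suc (suc (suc (suc zero))))            = z≤n
    entering≤isSpare (suc (suc (suc (suc (suc zero)))))      = z≤n
    entering≤isSpare e@(suc (suc (suc (suc (suc (suc _)))))) = entering-≤1 (edge e) (o e)

  3≤outflow : 3 ≤ outflow gadget o
  3≤outflow = ∑-mono-≤ {f = isDistinguished} isDistinguished≤leaving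
    where
    isDistinguished≤leaving : ∀ e → isDistinguished e ≤ leaving (edge e) (o e)
    isDistinguished≤leaving zero                rewrite o₁ = s≤s z≤n
    isDistinguished≤leaving (suc zero)          rewrite o₂ = s≤s z≤n
    isDistinguished≤leaving (suc (suc zero))    rewrite o₃ = s≤s z≤n
    isDistinguished≤leaving (suc (suc (suc _))) = z≤n

all-away-not-extendable : ¬ Extends3 gadget (# 0) bwd (# 1) bwd (# 2) bwd
all-away-not-extendable (o , is-o , o₁ , o₂ , o₃) = n≮n 6 (begin
  7                     ≤⟨ +-monoʳ-≤ 4 (3≤outflow o o₁ o₂ o₃) ⟩
  4 + outflow gadget o  ≡⟨ orientation-balance gadget o is-o ⟩
  3 + inflow gadget o   ≤⟨ +-monoʳ-≤ 3 (inflow≤3 o o₁ o₂ o₃) ⟩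
  6                     ∎)
  where open ≤-Reasoning

-- A spoke i with eᵢ toward sends its out-edge to the hub and leaves fᵢ undirected; every
-- other spoke j leaves its hub edge undirected and directs fⱼ opposite to eⱼ.
extendable-unless-all-away : ∀ (d₁ d₂ d₃ : Dir) → (d₁ ≡ toward ⊎ d₂ ≡ toward ⊎ d₃ ≡ toward) →
  Extends3 gadget (# 0) (dirStatus d₁) (# 1) (dirStatus d₂) (# 2) (dirStatus d₃)
extendable-unless-all-away toward toward toward _ =
  extends3-by gadget (lookup (fwd ∷ fwd ∷ fwd ∷ fwd ∷ und ∷ und ∷ und ∷ bwd ∷ bwd ∷ [])) _
extendable-unless-all-away toward toward away   _ =
  extends3-by gadget (lookup (fwd ∷ fwd ∷ bwd ∷ fwd ∷ und ∷ und ∷ und ∷ bwd ∷ fwd ∷ [])) _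
extendable-unless-all-away toward away   toward _ =
  extends3-by gadget (lookup (fwd ∷ bwd ∷ fwd ∷ fwd ∷ und ∷ und ∷ und ∷ fwd ∷ bwd ∷ [])) _
extendable-unless-all-away toward away   away   _ =
  extends3-by gadget (lookup (fwd ∷ bwd ∷ bwd ∷ fwd ∷ und ∷ und ∷ und ∷ fwd ∷ fwd ∷ [])) _
extendable-unless-all-away away   toward toward _ =
  extends3-by gadget (lookup (bwd ∷ fwd ∷ fwd ∷ und ∷ fwd ∷ und ∷ fwd ∷ und ∷ bwd ∷ [])) _
extendable-unless-all-away away   toward away   _ =
  extends3-by gadget (lookup (bwd ∷ fwd ∷ bwd ∷ und ∷ fwd ∷ und ∷ fwd ∷ und ∷ fwd ∷ [])) _
extendable-unless-all-away away   away   toward _ =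
  extends3-by gadget (lookup (bwd ∷ bwd ∷ fwd ∷ und ∷ und ∷ fwd ∷ fwd ∷ fwd ∷ und ∷ [])) _
extendable-unless-all-away away   away   away   (inj₁ ())
extendable-unless-all-away away   away   away   (inj₂ (inj₁ ()))
extendable-unless-all-away away   away   away   (inj₂ (inj₂ ()))

mainTheorem3 : Σ SubgraphUE λ G →
    (∀ v → SubgraphUE.ρ G v ≤ 1 × SubgraphUE.δ G v ≤ 1) ×
    Σ (Fin (SubgraphUE.m G)) λ e₁ → Σ (Fin (SubgraphUE.m G)) λ e₂ → Σ (Fin (SubgraphUE.m G)) λ e₃ →
      (e₁ ≢ e₂ × e₁ ≢ e₃ × e₂ ≢ e₃) ×
      (IsUnfinished G e₁ × IsUnfinished G e₂ × IsUnfinished G e₃) ×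
      (∀ (d₁ d₂ d₃ : Dir) → (d₁ ≡ toward ⊎ d₂ ≡ toward ⊎ d₃ ≡ toward) →
        Extends3 G e₁ (dirStatus d₁) e₂ (dirStatus d₂) e₃ (dirStatus d₃)) ×
      ¬ Extends3 G e₁ bwd e₂ bwd e₃ bwd
mainTheorem3 =
  gadget , gadget-degrees ,
  # 0 , # 1 , # 2 ,
  ((λ ()) , (λ ()) , (λ ())) ,
  ((# 1 , refl) , (# 2 , refl) , (# 3 , refl)) ,
  extendable-unless-all-away ,
  all-away-not-extendable
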